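{- Let $w\in S_n$ contain the pattern $132$, and let $p=\max\{t : \exists\, i<t<j,\ w_i<w_j<w_t\}$ and $q=\max\{j : j>p,\ w_j<w_p,\ \exists\, i<p,\ w_i<w_j\}$. Then $(p,w_q)$ is an empty box of the Rothe pipedream $D(w)$, and the set of pivots of $(p,w_q)$ is $\{(i,w_i) : i\in I(wt_{p,q},p)\}$.
   Context: Boxes of the $n\times n$ grid are indexed $(i,j)$, row $i$ from top, column $j$ from left. The Rothe pipedream $D(w)$ of $w\in S_n$ is formed by drawing, for each $i$, a hook from the center of box $(i,w_i)$ going right to the east boundary and down to the south boundary; so $D(w)$ has an SE elbow exactly at each $(i,w_i)$, no NW elbows, and its empty boxes are $\{(i,j) : w_i>j,\ w^{ -1}(j)>i\}$ (the Rothe diagram of $w$). For an empty box $(a,b)$ of $D(w)$, an SE elbow $(k,w_k)$ with $k<a$ and $w_k<b$ is a pivot of $(a,b)$ if the rectangle with northwest corner $(k,w_k)$ and southeast corner $(a,b)$ contains no other elbow (no other $(k',w_{k'})$). $\ell(u)$ is the number of inversions, $ut_{a,b}$ swaps entries in positions $a,b$, and $I(u,k)=\{i<k:\ell(ut_{i,k})=\ell(u)+1\}$. -}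

module Defs where

open import Data.Nat as ℕ using (ℕ; suc)
open import Data.Fin using (Fin; _<_; _≤_; _<?_)
open import Data.Fin.Permutation using (Permutation′; _⟨$⟩ʳ_; _⟨$⟩ˡ_; transpose; _∘ₚ_)
open import Data.List using (List; length; filter; cartesianProduct; allFin)
open import Data.Product using (_×_; _,_; ∃; ∃-syntax; proj₁; proj₂)
open import Relation.Binary.PropositionalEquality using (_≡_; _≢_)
open import Relation.Nullary using (¬_)
open import Data.Empty using (⊥)
open import Relation.Nullary.Decidable using (_×-dec_)

-- Permutations w ∈ S_n are bijections Fin n ↔ Fin n; positions/values are
-- 0-indexed (order-isomorphic to the paper's 1-indexing).  w ⟨$⟩ʳ i = w_i.

Contains132 : ∀ {n} → Permutation′ n → Set
Contains132 w = ∃[ i ] ∃[ j ] ∃[ k ]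
  (i < j × j < k × (w ⟨$⟩ʳ i) < (w ⟨$⟩ʳ k) × (w ⟨$⟩ʳ k) < (w ⟨$⟩ʳ j))

IsMax : ∀ {n} → (Fin n → Set) → Fin n → Set
IsMax P x = P x × (∀ y → P y → y ≤ x)

PSet : ∀ {n} → Permutation′ n → Fin n → Set
PSet w t = ∃[ i ] ∃[ j ]
  (i < t × t < j × (w ⟨$⟩ʳ i) < (w ⟨$⟩ʳ j) × (w ⟨$⟩ʳ j) < (w ⟨$⟩ʳ t))

QSet : ∀ {n} → Permutation′ n → Fin n → Fin n → Set
QSet w p j = p < j × (w ⟨$⟩ʳ j) < (w ⟨$⟩ʳ p) × (∃[ i ] (i < p × (w ⟨$⟩ʳ i) < (w ⟨$⟩ʳ j)))

EmptyBox : ∀ {n} → Permutation′ n → Fin n → Fin n → Set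
EmptyBox w a b = b < (w ⟨$⟩ʳ a) × a < (w ⟨$⟩ˡ b)

-- The SE elbow (k , w_k) is a pivot of the box (a , b): k < a, w_k < b,
-- and the closed rectangle with NW corner (k , w_k) and SE corner (a , b)
-- contains no other elbow (k' , w_k').
IsPivot : ∀ {n} → Permutation′ n → Fin n → Fin n → Fin n → Set
IsPivot w a b k = k < a × (w ⟨$⟩ʳ k) < b ×
  (∀ k' → k' ≢ k → k ≤ k' → k' ≤ a → (w ⟨$⟩ʳ k) ≤ (w ⟨$⟩ʳ k') → (w ⟨$⟩ʳ k') ≤ b → ⊥)

len : ∀ {n} → Permutation′ n → ℕ
len {n} u = length (filter (λ ij → (proj₁ ij <? proj₂ ij) ×-dec ((u ⟨$⟩ʳ proj₂ ij) <? (u ⟨$⟩ʳ proj₁ ij)))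
                           (cartesianProduct (allFin n) (allFin n)))

-- u t_{a,b}: swap the entries of u in positions a and b,
-- i.e. (u t_{a,b})_i = u_{t_{a,b}(i)}.
_·t[_,_] : ∀ {n} → Permutation′ n → Fin n → Fin n → Permutation′ n
u ·t[ a , b ] = transpose a b ∘ₚ u

InI : ∀ {n} → Permutation′ n → Fin n → Fin n → Set
InI u k i = i < k × len (u ·t[ i , k ]) ≡ suc (len u)

-- The box (p , w_q) is empty because p < q and w_q < w_p. For k < p the permutation
-- u = w t_{p,q} agrees with w and u_p = w_q, so both sides of the pivot equivalence say that
-- w_k < w_q and that no elbow lies strictly inside the rectangle with corners (k , w_k) and
-- (p , w_q); the boundary cases of IsPivot are excluded because (p , w_q) is empty.
-- On the side of I(u , p) this is the covering criterion for a transposition i < k: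
-- swapping the entries in positions i and k changes the inversion status only of the pairs
-- (i , k), (i , m) and (m , k) with i < m < k. If u_i < u_k, the pair (i , k) adds one
-- inversion and each m adds two when u_i < u_m < u_k and none otherwise; if u_k < u_i, the
-- pair (i , k) and every m can only remove inversions. Hence ℓ(u t_{i,k}) = ℓ(u) + 1 exactly
-- when u_i < u_k and no i < m < k has u_i < u_m < u_k.
module Submission where

open import Defs
open import Data.Nat using (ℕ)
open import Data.Fin using (Fin)
open import Data.Fin.Permutation using (Permutation′; _⟨$⟩ʳ_)
open import Data.Product using (_×_)
open import Function.Bundles using (_⇔_)

open import Data.Bool using (Bool; true; false; _∧_; _∨_; not; if_then_else_)
open import Data.Bool.Properties using (∧-comm; ∧-zeroʳ; ∧-inverseʳ; not-involutive)
open import Data.Empty using (⊥; ⊥-elim)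
open import Data.Fin using (zero; suc; _<_; _≤_; _<?_)
open import Data.Fin.Permutation using (_⟨$⟩ˡ_; inverseˡ; transpose)
import Data.Fin.Permutation.Components as PC
import Data.Fin.Properties as Finₚ
open import Data.Fin.Properties using (_≟_)
open import Data.List using (List; []; _∷_; _++_; length; filter; map; tabulate; cartesianProduct; allFin)
open import Data.List.Properties using (filter-++; length-++)
open import Data.Nat as ℕ using (zero; suc; _+_; z≤n; s≤s)
import Data.Nat.Properties as ℕₚ
open import Data.Nat.Properties using (+-0-commutativeMonoid)
open import Algebra.Properties.CommutativeMonoid.Sum +-0-commutativeMonoid
  using (sum; sum-syntax; ∑-distrib-+; ∑-comm; ∑-permute; sum-cong-≗; sum-replicate-zero)
open import Data.Product using (_,_)
open import Function using (_∘_; id)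
open import Function.Bundles using (Equivalence; mk⇔; Injection)
open import Function.Properties.Inverse using (↔⇒↣)
open import Relation.Binary using (tri<; tri≈; tri>)
open import Relation.Binary.PropositionalEquality
open import Relation.Nullary using (¬_; Dec; yes; no; does)
open import Relation.Nullary.Decidable using (dec-true; dec-false; _×-dec_)
open import Relation.Unary using (Pred; Decidable)

⟦_⟧ : Bool → ℕ
⟦ true ⟧ = 1
⟦ false ⟧ = 0

when : Bool → ℕ → ℕ
when b m = if b then m else 0

⟦∧⟧≡when : ∀ b c → ⟦ b ∧ c ⟧ ≡ when b ⟦ c ⟧
⟦∧⟧≡when true c = refl
⟦∧⟧≡when false c = refl

⟦∧⟧-exchange : ∀ c₁ c₂ d → ⟦ c₂ ∧ d ⟧ + ⟦ (c₁ ∧ not c₂) ∧ d ⟧ ≡ ⟦ c₁ ∧ d ⟧ + ⟦ (c₂ ∧ not c₁) ∧ d ⟧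
⟦∧⟧-exchange true true d = refl
⟦∧⟧-exchange true false d = sym (ℕₚ.+-identityʳ ⟦ d ⟧)
⟦∧⟧-exchange false true d = ℕₚ.+-identityʳ ⟦ d ⟧
⟦∧⟧-exchange false false d = refl

when-∧ : ∀ a b m → when (a ∧ b) m ≡ when a (when b m)
when-∧ true b m = refl
when-∧ false b m = refl

when-+ : ∀ b l m → when b (l + m) ≡ when b l + when b m
when-+ true l m = refl
when-+ false l m = refl

∑-when-≟ : ∀ {n} (a : Fin n) (f : Fin n → ℕ) → ∑[ y < n ] when (does (y ≟ a)) (f y) ≡ f a
∑-when-≟ {suc n} zero f = trans (cong (f zero +_) (sum-replicate-zero n)) (ℕₚ.+-identityʳ (f zero))
∑-when-≟ {suc n} (suc a) f = ∑-when-≟ a (f ∘ suc)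

∑-mono-≤ : ∀ {n} {f g : Fin n → ℕ} → (∀ x → f x ℕ.≤ g x) → sum f ℕ.≤ sum g
∑-mono-≤ {zero} _ = z≤n
∑-mono-≤ {suc n} f≤g = ℕₚ.+-mono-≤ (f≤g zero) (∑-mono-≤ (f≤g ∘ suc))

∑-mono-< : ∀ {n} {f g : Fin n → ℕ} (a : Fin n) → (∀ x → f x ℕ.≤ g x) → f a ℕ.< g a → sum f ℕ.< sum g
∑-mono-< zero f≤g fa<ga = ℕₚ.+-mono-<-≤ fa<ga (∑-mono-≤ (f≤g ∘ suc))
∑-mono-< (suc a) f≤g fa<ga = ℕₚ.+-mono-≤-< (f≤g zero) (∑-mono-< a (f≤g ∘ suc) fa<ga)

∑∑ : ∀ {n} → (Fin n → Fin n → ℕ) → ℕ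
∑∑ {n} f = ∑[ x < n ] ∑[ y < n ] f x y

∑∑-cong : ∀ {n} {f g : Fin n → Fin n → ℕ} → (∀ x y → f x y ≡ g x y) → ∑∑ f ≡ ∑∑ g
∑∑-cong f≡g = sum-cong-≗ (λ x → sum-cong-≗ (f≡g x))

∑∑-distrib-+ : ∀ {n} (f g : Fin n → Fin n → ℕ) → ∑∑ (λ x y → f x y + g x y) ≡ ∑∑ f + ∑∑ g
∑∑-distrib-+ f g = trans (sum-cong-≗ (λ x → ∑-distrib-+ (f x) (g x))) (∑-distrib-+ (sum ∘ f) (sum ∘ g))

module _ {p} {A : Set} {P : Pred A p} (P? : Decidable P) where

  length-filter-tabulate : ∀ {m} (h : Fin m → A) →
    length (filter P? (tabulate h)) ≡ ∑[ x < m ] ⟦ does (P? (h x)) ⟧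
  length-filter-tabulate {zero} h = refl
  length-filter-tabulate {suc m} h with does (P? (h zero))
  ... | true = cong suc (length-filter-tabulate (h ∘ suc))
  ... | false = length-filter-tabulate (h ∘ suc)

module _ {p} {A B : Set} {P : Pred (A × B) p} (P? : Decidable P) where

  length-filter-map-, : ∀ a (ys : List B) →
    length (filter P? (map (a ,_) ys)) ≡ length (filter (P? ∘ (a ,_)) ys)
  length-filter-map-, a [] = refl
  length-filter-map-, a (y ∷ ys) with does (P? (a , y))
  ... | true = cong suc (length-filter-map-, a ys)
  ... | false = length-filter-map-, a ys

  length-filter-cartesianProduct : ∀ {m} (h : Fin m → A) (ys : List B) →
    length (filter P? (cartesianProduct (tabulate h) ys)) ≡ ∑[ x < m ] length (filter (P? ∘ (h x ,_)) ys)
  length-filter-cartesianProduct {zero} h ys = refl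
  length-filter-cartesianProduct {suc m} h ys = begin
    length (filter P? (row ++ rest))
      ≡⟨ cong length (filter-++ P? row rest) ⟩
    length (filter P? row ++ filter P? rest)
      ≡⟨ length-++ (filter P? row) ⟩
    length (filter P? row) + length (filter P? rest)
      ≡⟨ cong₂ _+_ (length-filter-map-, (h zero) ys) (length-filter-cartesianProduct (h ∘ suc) ys) ⟩
    ∑[ x < suc m ] length (filter (P? ∘ (h x ,_)) ys)
      ∎
    where
    open ≡-Reasoning
    row : List (A × B)
    row = map (h zero ,_) ys
    rest : List (A × B)
    rest = cartesianProduct (tabulate (h ∘ suc)) ys

_<ᵇ_ : ∀ {n} → Fin n → Fin n → Bool
a <ᵇ b = does (a <? b)

<ᵇ-true : ∀ {n} {a b : Fin n} → a < b → a <ᵇ b ≡ true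
<ᵇ-true {a = a} {b} = dec-true (a <? b)

<ᵇ-false : ∀ {n} {a b : Fin n} → ¬ a < b → a <ᵇ b ≡ false
<ᵇ-false {a = a} {b} = dec-false (a <? b)

<ᵇ-flip : ∀ {n} {a b : Fin n} → a ≢ b → b <ᵇ a ≡ not (a <ᵇ b)
<ᵇ-flip {a = a} {b} a≢b with Finₚ.<-cmp a b
... | tri< a<b _ b≮a = trans (<ᵇ-false b≮a) (cong not (sym (<ᵇ-true a<b)))
... | tri≈ _ a≡b _ = ⊥-elim (a≢b a≡b)
... | tri> a≮b _ b<a = trans (<ᵇ-true b<a) (cong not (sym (<ᵇ-false a≮b)))

<ᵇ-irrefl : ∀ {n} (a : Fin n) → a <ᵇ a ≡ false
<ᵇ-irrefl a = <ᵇ-false {a = a} {a} (Finₚ.<-irrefl refl)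

len≡∑∑ : ∀ {n} (u : Permutation′ n) →
  len u ≡ ∑∑ (λ x y → ⟦ x <ᵇ y ∧ (u ⟨$⟩ʳ y) <ᵇ (u ⟨$⟩ʳ x) ⟧)
len≡∑∑ {n} u = trans (length-filter-cartesianProduct inversion? id (allFin n))
                     (sum-cong-≗ (λ x → length-filter-tabulate (inversion? ∘ (x ,_)) id))
  where
  inversion? : (ij : Fin n × Fin n) → Dec _
  inversion? (i , j) = (i <? j) ×-dec ((u ⟨$⟩ʳ j) <? (u ⟨$⟩ʳ i))

-- For i < m < k and (a , b , c) = (u i , u m , u k), the pairs (i , m) and (m , k) are
-- inverted descents a b c times in u and ascents a b c times in u ·t[ i , k ].
descents ascents : ∀ {n} → Fin n → Fin n → Fin n → ℕ
descents a b c = ⟦ b <ᵇ a ⟧ + ⟦ c <ᵇ b ⟧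
ascents a b c = ⟦ a <ᵇ b ⟧ + ⟦ b <ᵇ c ⟧

module _ {n} {a b c : Fin n} (b≢a : b ≢ a) (b≢c : b ≢ c) where

  private
    descents-via-ascending : descents a b c ≡ ⟦ not (a <ᵇ b) ⟧ + ⟦ not (b <ᵇ c) ⟧
    descents-via-ascending = cong₂ (λ x y → ⟦ x ⟧ + ⟦ y ⟧) (<ᵇ-flip (b≢a ∘ sym)) (<ᵇ-flip b≢c)

  descents<ascents : a < b → b < c → descents a b c ℕ.< ascents a b c
  descents<ascents a<b b<c rewrite descents-via-ascending | <ᵇ-true a<b | <ᵇ-true b<c = s≤s z≤n

  descents≡ascents : a < c → ¬ (a < b × b < c) → descents a b c ≡ ascents a b c
  descents≡ascents a<c ¬a<b<c = trans descents-via-ascending (balanced (a <? b) (b <? c))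
    where
    balanced : (a<?b : Dec (a < b)) (b<?c : Dec (b < c)) →
      ⟦ not (does a<?b) ⟧ + ⟦ not (does b<?c) ⟧ ≡ ⟦ does a<?b ⟧ + ⟦ does b<?c ⟧
    balanced (yes a<b) (yes b<c) = ⊥-elim (¬a<b<c (a<b , b<c))
    balanced (yes _) (no _) = refl
    balanced (no _) (yes _) = refl
    balanced (no a≮b) (no b≮c) =
      ⊥-elim (ℕₚ.<-irrefl refl (ℕₚ.<-≤-trans a<c (ℕₚ.≤-trans (ℕₚ.≮⇒≥ b≮c) (ℕₚ.≮⇒≥ a≮b))))

  descents≤ascents : a < c → descents a b c ℕ.≤ ascents a b c
  descents≤ascents a<c with (a <? b) ×-dec (b <? c)
  ... | yes (a<b , b<c) = ℕₚ.<⇒≤ (descents<ascents a<b b<c)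
  ... | no ¬a<b<c = ℕₚ.≤-reflexive (descents≡ascents a<c ¬a<b<c)

ascents≤descents : ∀ {n} {a b c : Fin n} → b ≢ a → b ≢ c → c < a → ascents a b c ℕ.≤ descents a b c
ascents≤descents {b = b} {c} b≢a b≢c c<a =
  subst₂ ℕ._≤_ (ℕₚ.+-comm ⟦ b <ᵇ c ⟧ _) (ℕₚ.+-comm ⟦ c <ᵇ b ⟧ _) (descents≤ascents b≢c b≢a c<a)

module _ {n} (i j : Fin n) where

  transpose-matchˡ : PC.transpose i j i ≡ j
  transpose-matchˡ rewrite dec-true (i ≟ i) refl = refl

  transpose-matchʳ : PC.transpose i j j ≡ i
  transpose-matchʳ with j ≟ i
  ... | yes j≡i = j≡i
  ... | no _ rewrite dec-true (j ≟ j) refl = refl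

  transpose-other : ∀ {x} → x ≢ i → x ≢ j → PC.transpose i j x ≡ x
  transpose-other {x} x≢i x≢j rewrite dec-false (x ≟ i) x≢i | dec-false (x ≟ j) x≢j = refl

EmptyRectangle : ∀ {n} → Permutation′ n → Fin n → Fin n → Fin n → Set
EmptyRectangle w i a b = ∀ m → i < m → m < a → (w ⟨$⟩ʳ i) < (w ⟨$⟩ʳ m) → (w ⟨$⟩ʳ m) < b → ⊥

module Transposition {n} (u : Permutation′ n) (i k : Fin n) (i<k : i < k) where

  private
    U : Fin n → Fin n
    U = u ⟨$⟩ʳ_

    U-injective : ∀ {x y} → U x ≡ U y → x ≡ y
    U-injective = Injection.injective (↔⇒↣ u)

    i≢k : i ≢ k
    i≢k = Finₚ.<⇒≢ i<k

    -- The inverse of the swap PC.transpose i k performed by u ·t[ i , k ].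
    T : Fin n → Fin n
    T = PC.transpose k i

    T-injective : ∀ {x y} → T x ≡ T y → x ≡ y
    T-injective {x} {y} Tx≡Ty = begin
      x                            ≡⟨ PC.transpose-inverse i k ⟨
      PC.transpose i k (T x)       ≡⟨ cong (PC.transpose i k) Tx≡Ty ⟩
      PC.transpose i k (T y)       ≡⟨ PC.transpose-inverse i k ⟩
      y                            ∎
      where open ≡-Reasoning

    inside : Fin n → Bool
    inside m = i <ᵇ m ∧ m <ᵇ k

    reversed : Fin n → Fin n → Bool
    reversed x y = x <ᵇ y ∧ not (T x <ᵇ T y)

    reversed-i : ∀ y → reversed i y ≡ does (y ≟ k) ∨ inside y
    reversed-i y = cases (y ≟ k) (y ≟ i)
      where
      cases : (y≟k : Dec (y ≡ k)) → Dec (y ≡ i) → reversed i y ≡ does y≟k ∨ inside y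
      cases (yes refl) _ rewrite transpose-matchʳ k i | transpose-matchˡ k i
                               | <ᵇ-true i<k | <ᵇ-false (Finₚ.<-asym i<k) = refl
      cases (no _) (yes refl) rewrite <ᵇ-irrefl i = refl
      cases (no y≢k) (no y≢i) rewrite transpose-matchʳ k i | transpose-other k i y≢k y≢i
                                    | <ᵇ-flip y≢k | not-involutive (y <ᵇ k) = refl

    reversed-k : ∀ y → reversed k y ≡ false
    reversed-k y = cases (y ≟ i) (y ≟ k)
      where
      cases : Dec (y ≡ i) → Dec (y ≡ k) → reversed k y ≡ false
      cases (yes refl) _ rewrite <ᵇ-false (Finₚ.<-asym i<k) = refl
      cases (no _) (yes refl) rewrite <ᵇ-irrefl k = refl
      cases (no y≢i) (no y≢k) rewrite transpose-matchˡ k i | transpose-other k i y≢k y≢i with k <? y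
      ... | yes k<y rewrite <ᵇ-true (Finₚ.<-trans i<k k<y) = ∧-zeroʳ (k <ᵇ y)
      ... | no k≮y rewrite <ᵇ-false k≮y = refl

    reversed-other : ∀ {x} → x ≢ i → x ≢ k → ∀ y → reversed x y ≡ does (y ≟ k) ∧ inside x
    reversed-other {x} x≢i x≢k y rewrite transpose-other k i x≢k x≢i = cases (y ≟ k) (y ≟ i)
      where
      cases : (y≟k : Dec (y ≡ k)) → Dec (y ≡ i) → x <ᵇ y ∧ not (x <ᵇ T y) ≡ does y≟k ∧ inside x
      cases (yes refl) _ rewrite transpose-matchˡ k i | <ᵇ-flip (x≢i ∘ sym) | not-involutive (i <ᵇ x) =
        ∧-comm (x <ᵇ k) (i <ᵇ x)
      cases (no _) (yes refl) rewrite transpose-matchʳ k i with x <? i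
      ... | yes x<i rewrite <ᵇ-true (Finₚ.<-trans x<i i<k) = ∧-zeroʳ (x <ᵇ i)
      ... | no x≮i rewrite <ᵇ-false x≮i = refl
      cases (no y≢k) (no y≢i) rewrite transpose-other k i y≢k y≢i = ∧-inverseʳ (x <ᵇ y)

    ∑∑-when-reversed : (g : Fin n → Fin n → ℕ) →
      ∑∑ (λ x y → when (reversed x y) (g x y)) ≡ g i k + ∑[ m < n ] when (inside m) (g i m + g m k)
    ∑∑-when-reversed g = begin
      ∑∑ (λ x y → when (reversed x y) (g x y))
        ≡⟨ sum-cong-≗ row ⟩
      ∑[ x < n ] (when (does (x ≟ i)) rowᵢ + when (inside x) (g x k))
        ≡⟨ ∑-distrib-+ (λ x → when (does (x ≟ i)) rowᵢ) (λ x → when (inside x) (g x k)) ⟩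
      ∑[ x < n ] when (does (x ≟ i)) rowᵢ + ∑[ m < n ] when (inside m) (g m k)
        ≡⟨ cong (_+ ∑[ m < n ] when (inside m) (g m k)) (∑-when-≟ i (λ _ → rowᵢ)) ⟩
      g i k + ∑[ m < n ] when (inside m) (g i m) + ∑[ m < n ] when (inside m) (g m k)
        ≡⟨ ℕₚ.+-assoc (g i k) _ _ ⟩
      g i k + (∑[ m < n ] when (inside m) (g i m) + ∑[ m < n ] when (inside m) (g m k))
        ≡⟨ cong (g i k +_) (∑-distrib-+ (λ m → when (inside m) (g i m)) (λ m → when (inside m) (g m k))) ⟨
      g i k + ∑[ m < n ] (when (inside m) (g i m) + when (inside m) (g m k))
        ≡⟨ cong (g i k +_) (sum-cong-≗ (λ m → when-+ (inside m) (g i m) (g m k))) ⟨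
      g i k + ∑[ m < n ] when (inside m) (g i m + g m k)
        ∎
      where
      open ≡-Reasoning

      rowᵢ : ℕ
      rowᵢ = g i k + ∑[ m < n ] when (inside m) (g i m)

      split-rowᵢ : ∀ y → when (reversed i y) (g i y) ≡ when (does (y ≟ k)) (g i y) + when (inside y) (g i y)
      split-rowᵢ y rewrite reversed-i y with y ≟ k
      ... | yes refl rewrite <ᵇ-irrefl k | <ᵇ-true i<k = sym (ℕₚ.+-identityʳ (g i k))
      ... | no _ = refl

      row : ∀ x → ∑[ y < n ] when (reversed x y) (g x y) ≡ when (does (x ≟ i)) rowᵢ + when (inside x) (g x k)
      row x = cases (x ≟ i) (x ≟ k)
        where
        cases : (x≟i : Dec (x ≡ i)) → Dec (x ≡ k) →
          ∑[ y < n ] when (reversed x y) (g x y) ≡ when (does x≟i) rowᵢ + when (inside x) (g x k)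
        cases (yes refl) _ rewrite <ᵇ-irrefl i = begin
          ∑[ y < n ] when (reversed i y) (g i y)
            ≡⟨ sum-cong-≗ split-rowᵢ ⟩
          ∑[ y < n ] (when (does (y ≟ k)) (g i y) + when (inside y) (g i y))
            ≡⟨ ∑-distrib-+ (λ y → when (does (y ≟ k)) (g i y)) (λ y → when (inside y) (g i y)) ⟩
          ∑[ y < n ] when (does (y ≟ k)) (g i y) + ∑[ m < n ] when (inside m) (g i m)
            ≡⟨ cong (_+ ∑[ m < n ] when (inside m) (g i m)) (∑-when-≟ k (g i)) ⟩
          rowᵢ
            ≡⟨ ℕₚ.+-identityʳ rowᵢ ⟨
          rowᵢ + 0
            ∎
        cases (no _) (yes refl) rewrite <ᵇ-irrefl k | ∧-zeroʳ (i <ᵇ k) =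
          trans (sum-cong-≗ (λ y → cong (λ b → when b (g k y)) (reversed-k y))) (sum-replicate-zero n)
        cases (no x≢i) (no x≢k) = begin
          ∑[ y < n ] when (reversed x y) (g x y)
            ≡⟨ sum-cong-≗ (λ y → cong (λ b → when b (g x y)) (reversed-other x≢i x≢k y)) ⟩
          ∑[ y < n ] when (does (y ≟ k) ∧ inside x) (g x y)
            ≡⟨ sum-cong-≗ (λ y → when-∧ (does (y ≟ k)) (inside x) (g x y)) ⟩
          ∑[ y < n ] when (does (y ≟ k)) (when (inside x) (g x y))
            ≡⟨ ∑-when-≟ k (λ y → when (inside x) (g x y)) ⟩
          when (inside x) (g x k)
            ∎

    len-·t≡∑∑ : len (u ·t[ i , k ]) ≡ ∑∑ (λ x y → ⟦ T x <ᵇ T y ∧ U y <ᵇ U x ⟧)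
    len-·t≡∑∑ = begin
      len (u ·t[ i , k ])
        ≡⟨ len≡∑∑ (u ·t[ i , k ]) ⟩
      ∑∑ swapped
        ≡⟨ ∑-permute (sum ∘ swapped) (transpose k i) ⟩
      ∑[ x < n ] ∑[ y < n ] swapped (T x) y
        ≡⟨ sum-cong-≗ (λ x → ∑-permute (swapped (T x)) (transpose k i)) ⟩
      ∑∑ (λ x y → swapped (T x) (T y))
        ≡⟨ ∑∑-cong (λ x y → cong₂ (λ a b → ⟦ T x <ᵇ T y ∧ U a <ᵇ U b ⟧)
                                  (PC.transpose-inverse i k) (PC.transpose-inverse i k)) ⟩
      ∑∑ (λ x y → ⟦ T x <ᵇ T y ∧ U y <ᵇ U x ⟧)
        ∎
      where
      open ≡-Reasoning
      swapped : Fin n → Fin n → ℕ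
      swapped x y = ⟦ x <ᵇ y ∧ U (PC.transpose i k y) <ᵇ U (PC.transpose i k x) ⟧

    reversed-flip : ∀ x y → T y <ᵇ T x ∧ not (y <ᵇ x) ≡ reversed x y
    reversed-flip x y with x ≟ y
    ... | yes refl rewrite <ᵇ-irrefl x | <ᵇ-irrefl (T x) = refl
    ... | no x≢y rewrite <ᵇ-flip (x≢y ∘ T-injective) | <ᵇ-flip x≢y | not-involutive (x <ᵇ y) =
      ∧-comm (not (T x <ᵇ T y)) (x <ᵇ y)

    len-exchange : len (u ·t[ i , k ]) + ∑∑ (λ x y → ⟦ reversed x y ∧ U y <ᵇ U x ⟧)
                 ≡ len u + ∑∑ (λ x y → ⟦ reversed x y ∧ U x <ᵇ U y ⟧)
    len-exchange = begin
      len (u ·t[ i , k ]) + ∑∑ down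
        ≡⟨ cong (_+ ∑∑ down) len-·t≡∑∑ ⟩
      ∑∑ (λ x y → ⟦ T x <ᵇ T y ∧ U y <ᵇ U x ⟧) + ∑∑ down
        ≡⟨ ∑∑-distrib-+ (λ x y → ⟦ T x <ᵇ T y ∧ U y <ᵇ U x ⟧) down ⟨
      ∑∑ (λ x y → ⟦ T x <ᵇ T y ∧ U y <ᵇ U x ⟧ + down x y)
        ≡⟨ ∑∑-cong (λ x y → ⟦∧⟧-exchange (x <ᵇ y) (T x <ᵇ T y) (U y <ᵇ U x)) ⟩
      ∑∑ (λ x y → ⟦ x <ᵇ y ∧ U y <ᵇ U x ⟧ + up′ x y)
        ≡⟨ ∑∑-distrib-+ (λ x y → ⟦ x <ᵇ y ∧ U y <ᵇ U x ⟧) up′ ⟩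
      ∑∑ (λ x y → ⟦ x <ᵇ y ∧ U y <ᵇ U x ⟧) + ∑∑ up′
        ≡⟨ cong₂ _+_ (sym (len≡∑∑ u)) (∑-comm up′) ⟩
      len u + ∑∑ (λ x y → up′ y x)
        ≡⟨ cong (len u +_) (∑∑-cong (λ x y → cong (λ b → ⟦ b ∧ U x <ᵇ U y ⟧) (reversed-flip x y))) ⟩
      len u + ∑∑ (λ x y → ⟦ reversed x y ∧ U x <ᵇ U y ⟧)
        ∎
      where
      open ≡-Reasoning
      down up′ : Fin n → Fin n → ℕ
      down x y = ⟦ reversed x y ∧ U y <ᵇ U x ⟧
      up′ x y = ⟦ (T x <ᵇ T y ∧ not (x <ᵇ y)) ∧ U y <ᵇ U x ⟧

    descents-inside ascents-inside : Fin n → ℕ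
    descents-inside m = when (inside m) (descents (U i) (U m) (U k))
    ascents-inside m = when (inside m) (ascents (U i) (U m) (U k))

    len-balance : len (u ·t[ i , k ]) + (⟦ U k <ᵇ U i ⟧ + sum descents-inside)
                ≡ len u + (⟦ U i <ᵇ U k ⟧ + sum ascents-inside)
    len-balance = begin
      len (u ·t[ i , k ]) + (⟦ U k <ᵇ U i ⟧ + sum descents-inside)
        ≡⟨ cong (len (u ·t[ i , k ]) +_) (count (λ x y → U y <ᵇ U x)) ⟨
      len (u ·t[ i , k ]) + ∑∑ (λ x y → ⟦ reversed x y ∧ U y <ᵇ U x ⟧)
        ≡⟨ len-exchange ⟩
      len u + ∑∑ (λ x y → ⟦ reversed x y ∧ U x <ᵇ U y ⟧)
        ≡⟨ cong (len u +_) (count (λ x y → U x <ᵇ U y)) ⟩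
      len u + (⟦ U i <ᵇ U k ⟧ + sum ascents-inside)
        ∎
      where
      open ≡-Reasoning
      count : (h : Fin n → Fin n → Bool) →
        ∑∑ (λ x y → ⟦ reversed x y ∧ h x y ⟧) ≡ ⟦ h i k ⟧ + ∑[ m < n ] when (inside m) (⟦ h i m ⟧ + ⟦ h m k ⟧)
      count h = trans (∑∑-cong (λ x y → ⟦∧⟧≡when (reversed x y) (h x y)))
                      (∑∑-when-reversed (λ x y → ⟦ h x y ⟧))

    balance-< : U i < U k → len (u ·t[ i , k ]) + sum descents-inside ≡ len u + suc (sum ascents-inside)
    balance-< Ui<Uk = subst₂ (λ b c → len (u ·t[ i , k ]) + (⟦ b ⟧ + sum descents-inside)
                                     ≡ len u + (⟦ c ⟧ + sum ascents-inside))
                             (<ᵇ-false (Finₚ.<-asym Ui<Uk)) (<ᵇ-true Ui<Uk) len-balance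

    balance-> : U k < U i → len (u ·t[ i , k ]) + suc (sum descents-inside) ≡ len u + sum ascents-inside
    balance-> Uk<Ui = subst₂ (λ b c → len (u ·t[ i , k ]) + (⟦ b ⟧ + sum descents-inside)
                                     ≡ len u + (⟦ c ⟧ + sum ascents-inside))
                             (<ᵇ-true Uk<Ui) (<ᵇ-false (Finₚ.<-asym Uk<Ui)) len-balance

    inside-pointwise : (R : ℕ → ℕ → Set) → R 0 0 →
      (∀ m → i < m → m < k → U m ≢ U i → U m ≢ U k →
         R (descents (U i) (U m) (U k)) (ascents (U i) (U m) (U k))) →
      ∀ m → R (descents-inside m) (ascents-inside m)
    inside-pointwise R R00 R-inside m with i <? m | m <? k
    ... | yes i<m | yes m<k rewrite <ᵇ-true i<m | <ᵇ-true m<k =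
      R-inside m i<m m<k (Finₚ.<⇒≢ i<m ∘ sym ∘ U-injective) (Finₚ.<⇒≢ m<k ∘ U-injective)
    ... | yes i<m | no m≮k rewrite <ᵇ-true i<m | <ᵇ-false m≮k = R00
    ... | no i≮m | _ rewrite <ᵇ-false i≮m = R00

    len-·t≢suc : U k < U i → len (u ·t[ i , k ]) ≢ suc (len u)
    len-·t≢suc Uk<Ui eq = ℕₚ.<-irrefl (sym (balance-> Uk<Ui)) (begin-strict
      len u + sum ascents-inside
        ≤⟨ ℕₚ.+-monoʳ-≤ (len u) (∑-mono-≤ (inside-pointwise ℕ._≥_ z≤n
             (λ m _ _ Um≢Ui Um≢Uk → ascents≤descents Um≢Ui Um≢Uk Uk<Ui))) ⟩
      len u + sum descents-inside
        <⟨ ℕₚ.+-mono-< (ℕₚ.n<1+n (len u)) (ℕₚ.n<1+n _) ⟩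
      suc (len u) + suc (sum descents-inside)
        ≡⟨ cong (_+ suc (sum descents-inside)) eq ⟨
      len (u ·t[ i , k ]) + suc (sum descents-inside)
        ∎)
      where open ℕₚ.≤-Reasoning

    len-·t≡suc⇔balanced : U i < U k →
      len (u ·t[ i , k ]) ≡ suc (len u) ⇔ sum descents-inside ≡ sum ascents-inside
    len-·t≡suc⇔balanced Ui<Uk = mk⇔ to from
      where
      open ≡-Reasoning
      to : len (u ·t[ i , k ]) ≡ suc (len u) → sum descents-inside ≡ sum ascents-inside
      to eq = ℕₚ.+-cancelˡ-≡ (len u) _ _ (ℕₚ.suc-injective (begin
        suc (len u) + sum descents-inside           ≡⟨ cong (_+ sum descents-inside) eq ⟨
        len (u ·t[ i , k ]) + sum descents-inside   ≡⟨ balance-< Ui<Uk ⟩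
        len u + suc (sum ascents-inside)            ≡⟨ ℕₚ.+-suc (len u) _ ⟩
        suc (len u + sum ascents-inside)            ∎))
      from : sum descents-inside ≡ sum ascents-inside → len (u ·t[ i , k ]) ≡ suc (len u)
      from balanced = ℕₚ.+-cancelʳ-≡ (sum descents-inside) _ _ (begin
        len (u ·t[ i , k ]) + sum descents-inside   ≡⟨ balance-< Ui<Uk ⟩
        len u + suc (sum ascents-inside)            ≡⟨ ℕₚ.+-suc (len u) _ ⟩
        suc (len u + sum ascents-inside)            ≡⟨ cong (λ s → suc (len u + s)) balanced ⟨
        suc (len u) + sum descents-inside           ∎)

    balanced⇔empty : U i < U k → sum descents-inside ≡ sum ascents-inside ⇔ EmptyRectangle u i k (U k)
    balanced⇔empty Ui<Uk = mk⇔ to from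
      where
      to : sum descents-inside ≡ sum ascents-inside → EmptyRectangle u i k (U k)
      to balanced m i<m m<k Ui<Um Um<Uk = ℕₚ.<-irrefl balanced (∑-mono-< m
        (inside-pointwise ℕ._≤_ z≤n (λ _ _ _ Um≢Ui Um≢Uk → descents≤ascents Um≢Ui Um≢Uk Ui<Uk))
        strict)
        where
        strict : descents-inside m ℕ.< ascents-inside m
        strict rewrite <ᵇ-true i<m | <ᵇ-true m<k =
          descents<ascents (Finₚ.<⇒≢ Ui<Um ∘ sym) (Finₚ.<⇒≢ Um<Uk) Ui<Um Um<Uk
      from : EmptyRectangle u i k (U k) → sum descents-inside ≡ sum ascents-inside
      from empty = sum-cong-≗ (inside-pointwise _≡_ refl (λ m i<m m<k Um≢Ui Um≢Uk →
        descents≡ascents Um≢Ui Um≢Uk Ui<Uk (λ (Ui<Um , Um<Uk) → empty m i<m m<k Ui<Um Um<Uk)))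

  len-·t≡suc⇔ : len (u ·t[ i , k ]) ≡ suc (len u) ⇔ (U i < U k × EmptyRectangle u i k (U k))
  len-·t≡suc⇔ = mk⇔ to from
    where
    to : len (u ·t[ i , k ]) ≡ suc (len u) → U i < U k × EmptyRectangle u i k (U k)
    to eq with Finₚ.<-cmp (U i) (U k)
    ... | tri< Ui<Uk _ _ =
      Ui<Uk , Equivalence.to (balanced⇔empty Ui<Uk) (Equivalence.to (len-·t≡suc⇔balanced Ui<Uk) eq)
    ... | tri≈ _ Ui≡Uk _ = ⊥-elim (i≢k (U-injective Ui≡Uk))
    ... | tri> _ _ Uk<Ui = ⊥-elim (len-·t≢suc Uk<Ui eq)
    from : U i < U k × EmptyRectangle u i k (U k) → len (u ·t[ i , k ]) ≡ suc (len u)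
    from (Ui<Uk , empty) =
      Equivalence.from (len-·t≡suc⇔balanced Ui<Uk) (Equivalence.from (balanced⇔empty Ui<Uk) empty)

isPivot⇔ : ∀ {n} (w : Permutation′ n) {a b : Fin n} → EmptyBox w a b →
  ∀ k → IsPivot w a b k ⇔ (k < a × (w ⟨$⟩ʳ k) < b × EmptyRectangle w k a b)
isPivot⇔ w {a} {b} (b<wa , a<w⁻¹b) k = mk⇔ to from
  where
  to : IsPivot w a b k → k < a × (w ⟨$⟩ʳ k) < b × EmptyRectangle w k a b
  to (k<a , wk<b , noElbow) = k<a , wk<b , λ m k<m m<a wk<wm wm<b →
    noElbow m (Finₚ.<⇒≢ k<m ∘ sym) (ℕₚ.<⇒≤ k<m) (ℕₚ.<⇒≤ m<a) (ℕₚ.<⇒≤ wk<wm) (ℕₚ.<⇒≤ wm<b)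

  from : k < a × (w ⟨$⟩ʳ k) < b × EmptyRectangle w k a b → IsPivot w a b k
  from (k<a , wk<b , empty) = k<a , wk<b , noElbow
    where
    noElbow : ∀ m → m ≢ k → k ≤ m → m ≤ a → (w ⟨$⟩ʳ k) ≤ (w ⟨$⟩ʳ m) → (w ⟨$⟩ʳ m) ≤ b → ⊥
    noElbow m m≢k k≤m m≤a wk≤wm wm≤b with m ≟ a
    ... | yes refl = ℕₚ.<⇒≱ b<wa wm≤b
    ... | no m≢a = empty m (Finₚ.≤∧≢⇒< k≤m (m≢k ∘ sym)) (Finₚ.≤∧≢⇒< m≤a m≢a)
      (Finₚ.≤∧≢⇒< wk≤wm (m≢k ∘ sym ∘ Injection.injective (↔⇒↣ w)))
      (Finₚ.≤∧≢⇒< wm≤b λ wm≡b →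
        ℕₚ.<⇒≱ (subst (a <_) (trans (cong (w ⟨$⟩ˡ_) (sym wm≡b)) (inverseˡ w)) a<w⁻¹b) m≤a)

EmptyRectangle-agree : ∀ {n} (u w : Permutation′ n) {k a b : Fin n} →
  (∀ m → m < a → u ⟨$⟩ʳ m ≡ w ⟨$⟩ʳ m) → k < a → EmptyRectangle u k a b → EmptyRectangle w k a b
EmptyRectangle-agree u w {b = b} u≗w k<a empty m k<m m<a wk<wm wm<b =
  empty m k<m m<a (subst₂ _<_ (sym (u≗w _ k<a)) (sym (u≗w m m<a)) wk<wm)
                  (subst (_< b) (sym (u≗w m m<a)) wm<b)

proposition4p5 : ∀ (n : ℕ) (w : Permutation′ n) → Contains132 w →
    ∀ (p q : Fin n) → IsMax (PSet w) p → IsMax (QSet w p) q →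
    EmptyBox w p (w ⟨$⟩ʳ q) ×
    (∀ (k : Fin n) → IsPivot w p (w ⟨$⟩ʳ q) k ⇔ InI (w ·t[ p , q ]) p k)
proposition4p5 n w _ p q _ ((p<q , wq<wp , _) , _) = emptyBox , pivots
  where
  u : Permutation′ n
  u = w ·t[ p , q ]

  emptyBox : EmptyBox w p (w ⟨$⟩ʳ q)
  emptyBox = wq<wp , subst (p <_) (sym (inverseˡ w)) p<q

  u-p : u ⟨$⟩ʳ p ≡ w ⟨$⟩ʳ q
  u-p = cong (w ⟨$⟩ʳ_) (transpose-matchˡ p q)

  u≗w : ∀ m → m < p → u ⟨$⟩ʳ m ≡ w ⟨$⟩ʳ m
  u≗w m m<p = cong (w ⟨$⟩ʳ_) (transpose-other p q (Finₚ.<⇒≢ m<p) (Finₚ.<⇒≢ (Finₚ.<-trans m<p p<q)))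

  pivots : ∀ k → IsPivot w p (w ⟨$⟩ʳ q) k ⇔ InI u p k
  pivots k = mk⇔ to from
    where
    to : IsPivot w p (w ⟨$⟩ʳ q) k → InI u p k
    to isPivot with k<p , wk<wq , empty ← Equivalence.to (isPivot⇔ w emptyBox k) isPivot =
      k<p , Equivalence.from (Transposition.len-·t≡suc⇔ u k p k<p)
        ( subst₂ _<_ (sym (u≗w k k<p)) (sym u-p) wk<wq
        , subst (EmptyRectangle u k p) (sym u-p)
                (EmptyRectangle-agree w u (λ m m<p → sym (u≗w m m<p)) k<p empty))
    from : InI u p k → IsPivot w p (w ⟨$⟩ʳ q) k
    from (k<p , lengthUp) with uk<up , empty ← Equivalence.to (Transposition.len-·t≡suc⇔ u k p k<p) lengthUp =
      Equivalence.from (isPivot⇔ w emptyBox k)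
        ( k<p , subst₂ _<_ (u≗w k k<p) u-p uk<up
        , EmptyRectangle-agree u w u≗w k<p (subst (EmptyRectangle u k p) u-p empty))
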